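{- Let $p$ be a prime, $n\in\mathbb{Z}^+$, $d\in[0,n]$ and $E\subseteq[0,n]$. Over $\mathbb{F}_p$: (a) If $j\in\operatorname{Z\text{ - }cl}_{n,d}(E)$, then $j\in\operatorname{Z\text{ - }cl}_{m,d}(E)$ for all $m>n$. (b) If $j\in\operatorname{Z\text{ - }cl}_{n,d}(E)$, then $n-j\in\operatorname{Z\text{ - }cl}_{n,d}(n-E)$, where $n-E=\{n-e:e\in E\}$. (c) If $j\in\operatorname{Z\text{ - }cl}_{n,d}(E)$, then $j+k\in\operatorname{Z\text{ - }cl}_{n+k,d}(E+k)$ for all $k>0$, where $E+k=\{e+k:e\in E\}$.
   Context: For integers $a\le b$, $[a,b]$ denotes the set of integers between $a$ and $b$. Work over $\mathbb{F}_p$ with $\{0,1\}^m\subseteq\mathbb{F}_p^m$; $|x|$ is the Hamming weight, and for $E\subseteq[0,m]$, $\underline{E}=\{x\in\{0,1\}^m:|x|\in E\}$. The degree-$d$ Zariski closure $\operatorname{Z\text{ - }cl}_{m,d}(\underline{E})$ is the set of $y\in\{0,1\}^m$ at which every polynomial in $\mathbb{F}_p[X_1,\dots,X_m]$ of degree at most $d$ vanishing on $\underline{E}\subseteq\{0,1\}^m$ also vanishes; it is symmetric and identified with its set of Hamming weights $\operatorname{Z\text{ - }cl}_{m,d}(E)\subseteq[0,m]$. -}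

module Defs where

open import Data.Nat using (ℕ; _+_; _*_; _∸_; _^_; _≤_)
open import Data.Nat.Divisibility using (_∣_)
open import Data.Bool using (Bool; true; false)
open import Data.Vec using (Vec; zipWith; map)
open import Data.List using (List)
open import Data.Nat.ListAction using (sum)
import Data.List as L
open import Data.Vec using () renaming (foldr′ to vfoldr)
open import Data.List.Relation.Unary.All using (All)
open import Data.Product using (_×_; _,_; ∃; ∃-syntax; proj₁; proj₂)
open import Relation.Binary.PropositionalEquality using (_≡_)

bit : Bool → ℕ
bit true  = 1
bit false = 0

vsum : ∀ {m} → Vec ℕ m → ℕ
vsum = vfoldr _+_ 0

vprod : ∀ {m} → Vec ℕ m → ℕ
vprod = vfoldr _*_ 1

weight : ∀ {m} → Vec Bool m → ℕ
weight x = vsum (map bit x)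

-- A monomial in X_1..X_m: exponent vector; a term: coefficient (an element of
-- F_p represented by a natural number) times a monomial.
Term : ℕ → Set
Term m = ℕ × Vec ℕ m

Poly : ℕ → Set
Poly m = List (Term m)

mdeg : ∀ {m} → Term m → ℕ
mdeg t = vsum (proj₂ t)

DegLe : ∀ {m} → ℕ → Poly m → Set
DegLe d P = All (λ t → mdeg t ≤ d) P

-- Evaluation of P at x ∈ {0,1}^m ⊆ F_p^m, computed in ℕ (reduce mod p afterwards).
evalTerm : ∀ {m} → Vec Bool m → Term m → ℕ
evalTerm x (c , es) = c * vprod (zipWith (λ b e → bit b ^ e) x es)

eval : ∀ {m} → Vec Bool m → Poly m → ℕ
eval x P = sum (L.map (evalTerm x) P)

Vanishes : ∀ {m} → ℕ → Poly m → Vec Bool m → Set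
Vanishes p P x = p ∣ eval x P

WSet : Set₁
WSet = ℕ → Set

InZcl : ℕ → (m d : ℕ) → WSet → Vec Bool m → Set
InZcl p m d E y =
  (P : Poly m) → DegLe d P →
  ((x : Vec Bool m) → E (weight x) → Vanishes p P x) →
  Vanishes p P y

-- j ∈ Z-cl_{m,d}(E) ⊆ [0,m]: j is the Hamming weight of a point of the
-- (symmetric) closure.
ZCl : ℕ → (m d : ℕ) → WSet → WSet
ZCl p m d E j = ∃[ y ] (weight {m} y ≡ j × InZcl p m d E y)

reflectSet : ℕ → WSet → WSet
reflectSet n E i = ∃[ e ] (E e × i ≡ n ∸ e)

shiftSet : ℕ → WSet → WSet
shiftSet k E i = ∃[ e ] (E e × i ≡ e + k)

{-# OPTIONS --safe #-}
module Submission where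

open import Defs
open import Data.Nat using (ℕ; zero; suc; _+_; _*_; _^_; _∸_; _%_; _≤_; _<_; z≤n; s≤s; NonZero; >-nonZero⁻¹)
open import Data.Nat.Properties
open import Data.Nat.DivMod using (%-distribˡ-+; %-distribˡ-*; m*n%n≡0)
open import Data.Nat.Divisibility using (_∣_; m%n≡0⇒n∣m; n∣m⇒m%n≡0)
open import Data.Nat.Primality using (Prime; prime⇒nonZero)
open import Data.Bool using (Bool; true; false; not)
open import Data.Vec using (Vec; []; _∷_; _++_; replicate; zipWith; map; take; drop)
import Data.List as L
import Data.List.Relation.Unary.All as All
open import Data.List.Relation.Unary.All using ([]; _∷_)
open import Data.List.Relation.Unary.All.Properties using (++⁺; map⁺)
open import Data.Product using (_×_; _,_)
open import Relation.Binary.PropositionalEquality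

-- All three parts come from substitutions that preserve degree. For (a) and (c),
-- a polynomial on {0,1}^(n+k) restricted to the points x ++ z, with z fixed, is a
-- polynomial of no larger degree on {0,1}^n; padding by zeros (resp. ones) moves
-- weights by 0 (resp. k). For (b), P(X) ↦ P(1 - X) preserves degree and swaps
-- x with its complement, whose weight is n - |x|.

monomial : ∀ {n} → Vec Bool n → Vec ℕ n → ℕ
monomial x es = vprod (zipWith (λ b e → bit b ^ e) x es)

eval-++ : ∀ {n} (x : Vec Bool n) (P Q : Poly n) → eval x (P L.++ Q) ≡ eval x P + eval x Q
eval-++ x L.[] Q = refl
eval-++ x (t L.∷ P) Q = trans (cong (evalTerm x t +_) (eval-++ x P Q)) (sym (+-assoc (evalTerm x t) _ _))

weight-++ : ∀ {n k} (x : Vec Bool n) (z : Vec Bool k) → weight (x ++ z) ≡ weight x + weight z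
weight-++ [] z = refl
weight-++ (b ∷ x) z = trans (cong (bit b +_) (weight-++ x z)) (sym (+-assoc (bit b) _ _))

weight-replicate-false : ∀ k → weight (replicate k false) ≡ 0
weight-replicate-false zero = refl
weight-replicate-false (suc k) = weight-replicate-false k

weight-replicate-true : ∀ k → weight (replicate k true) ≡ k
weight-replicate-true zero = refl
weight-replicate-true (suc k) = cong suc (weight-replicate-true k)

weight-map-not : ∀ {n} (x : Vec Bool n) → weight (map not x) ≡ n ∸ weight x
weight-map-not {n} x = trans (sym (m+n∸m≡n (weight x) _)) (cong (_∸ weight x) (weight+weight-map-not x))
  where
  weight+weight-map-not : ∀ {n} (x : Vec Bool n) → weight x + weight (map not x) ≡ n
  weight+weight-map-not [] = refl
  weight+weight-map-not (true ∷ x) = cong suc (weight+weight-map-not x)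
  weight+weight-map-not (false ∷ x) = trans (+-suc (weight x) _) (cong suc (weight+weight-map-not x))

monomial-++ : ∀ {n k} (x : Vec Bool n) (z : Vec Bool k) (es : Vec ℕ (n + k)) →
  monomial (x ++ z) es ≡ monomial x (take n es) * monomial z (drop n es)
monomial-++ [] z es = sym (+-identityʳ _)
monomial-++ (b ∷ x) z (e ∷ es) =
  trans (cong (bit b ^ e *_) (monomial-++ x z es)) (sym (*-assoc (bit b ^ e) _ _))

vsum-take : ∀ n {k} (es : Vec ℕ (n + k)) → vsum (take n es) ≤ vsum es
vsum-take zero es = z≤n
vsum-take (suc n) (e ∷ es) = +-monoʳ-≤ e (vsum-take n es)

restrict : ∀ n {k} → Vec Bool k → Poly (n + k) → Poly n
restrict n z = L.map λ (c , es) → c * monomial z (drop n es) , take n es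

eval-restrict : ∀ {n k} (x : Vec Bool n) (z : Vec Bool k) (P : Poly (n + k)) →
  eval x (restrict n z P) ≡ eval (x ++ z) P
eval-restrict x z L.[] = refl
eval-restrict {n} x z ((c , es) L.∷ P) = cong₂ _+_ evalTerm-restrict (eval-restrict x z P)
  where
  open ≡-Reasoning
  evalTerm-restrict : c * monomial z (drop n es) * monomial x (take n es) ≡ c * monomial (x ++ z) es
  evalTerm-restrict = begin
      c * monomial z (drop n es) * monomial x (take n es)
    ≡⟨ *-assoc c _ _ ⟩
      c * (monomial z (drop n es) * monomial x (take n es))
    ≡⟨ cong (c *_) (*-comm (monomial z (drop n es)) _) ⟩
      c * (monomial x (take n es) * monomial z (drop n es))
    ≡⟨ cong (c *_) (sym (monomial-++ x z es)) ⟩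
      c * monomial (x ++ z) es
    ∎

DegLe-restrict : ∀ {n k d} (z : Vec Bool k) (P : Poly (n + k)) → DegLe d P → DegLe d (restrict n z P)
DegLe-restrict {n} z P degP = map⁺ (All.map (λ {(_ , es)} → ≤-trans (vsum-take n es)) degP)

InZcl-++ : ∀ {p n k d E E'} (z : Vec Bool k) →
  ((x : Vec Bool n) → E (weight x) → E' (weight (x ++ z))) →
  (y : Vec Bool n) → InZcl p n d E y → InZcl p (n + k) d E' (y ++ z)
InZcl-++ {p} z E⇒E' y y∈cl P degP P-vanishes =
  subst (p ∣_) (eval-restrict y z P)
    (y∈cl (restrict _ z P) (DegLe-restrict z P degP)
      (λ x x∈E → subst (p ∣_) (sym (eval-restrict x z P)) (P-vanishes (x ++ z) (E⇒E' x x∈E))))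

ZCl-++ : ∀ {p n k d E E' j} (z : Vec Bool k) → ((e : ℕ) → E e → E' (e + weight z)) →
  ZCl p n d E j → ZCl p (n + k) d E' (j + weight z)
ZCl-++ {E = E} {E' = E'} z E⇒E' (y , refl , y∈cl) =
  y ++ z , weight-++ y z ,
  InZcl-++ {E = E} {E' = E'} z (λ x x∈E → subst E' (sym (weight-++ x z)) (E⇒E' (weight x) x∈E)) y y∈cl

module Complement (p : ℕ) .{{_ : NonZero p}} where

  infix 4 _≈_
  _≈_ : ℕ → ℕ → Set
  a ≈ b = a % p ≡ b % p

  ≈-+ : ∀ {a b c d} → a ≈ b → c ≈ d → a + c ≈ b + d
  ≈-+ {a} {b} {c} {d} a≈b c≈d =
    trans (%-distribˡ-+ a c p) (trans (cong₂ (λ u v → (u + v) % p) a≈b c≈d) (sym (%-distribˡ-+ b d p)))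

  ≈-*ˡ : ∀ c {a b} → a ≈ b → c * a ≈ c * b
  ≈-*ˡ c {a} {b} a≈b =
    trans (%-distribˡ-* c a p) (trans (cong (λ u → ((c % p) * u) % p) a≈b) (sym (%-distribˡ-* c b p)))

  p*≈0 : ∀ a → p * a ≈ 0
  p*≈0 a = trans (cong (_% p) (*-comm p a)) (trans (m*n%n≡0 a p) (sym (m*n%n≡0 0 p)))

  ∣-resp-≈ : ∀ {a b} → a ≈ b → p ∣ b → p ∣ a
  ∣-resp-≈ {a} {b} a≈b p∣b = m%n≡0⇒n∣m a p (trans a≈b (n∣m⇒m%n≡0 b p p∣b))

  extend : ∀ {n} → ℕ → Poly n → Poly (suc n)
  extend e = L.map λ (c , es) → c , e ∷ es

  scale : ∀ {n} → ℕ → Poly n → Poly n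
  scale k = L.map λ (c , es) → k * c , es

  eval-extend : ∀ {n} b (x : Vec Bool n) e (P : Poly n) → eval (b ∷ x) (extend e P) ≡ bit b ^ e * eval x P
  eval-extend b x e L.[] = sym (*-zeroʳ (bit b ^ e))
  eval-extend b x e ((c , es) L.∷ P) =
    trans (cong₂ _+_ evalTerm-extend (eval-extend b x e P)) (sym (*-distribˡ-+ (bit b ^ e) _ _))
    where
    evalTerm-extend : c * (bit b ^ e * monomial x es) ≡ bit b ^ e * (c * monomial x es)
    evalTerm-extend = trans (sym (*-assoc c _ _))
      (trans (cong (_* monomial x es) (*-comm c (bit b ^ e))) (*-assoc (bit b ^ e) c _))

  eval-scale : ∀ {n} (x : Vec Bool n) k (P : Poly n) → eval x (scale k P) ≡ k * eval x P
  eval-scale x k L.[] = sym (*-zeroʳ k)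
  eval-scale x k ((c , es) L.∷ P) =
    trans (cong₂ _+_ (*-assoc k c _) (eval-scale x k P)) (sym (*-distribˡ-+ k _ _))

  -- ∏ (1 - X_i) over the i with e_i > 0: on bits b ^ (e + 1) = b, and 1 - X is
  -- written 1 + (p - 1) X since coefficients are natural numbers.
  complement : ∀ {n} → Vec ℕ n → Poly n
  complement [] = (1 , []) L.∷ L.[]
  complement (zero ∷ es) = extend 0 (complement es)
  complement (suc e ∷ es) = extend 0 (complement es) L.++ extend 1 (scale (p ∸ 1) (complement es))

  eval-complement-suc : ∀ {n} b (x : Vec Bool n) e (es : Vec ℕ n) →
    eval (b ∷ x) (complement (suc e ∷ es)) ≡ eval x (complement es) + bit b * ((p ∸ 1) * eval x (complement es))
  eval-complement-suc b x e es = begin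
      eval (b ∷ x) (extend 0 C L.++ extend 1 (scale (p ∸ 1) C))
    ≡⟨ eval-++ (b ∷ x) (extend 0 C) _ ⟩
      eval (b ∷ x) (extend 0 C) + eval (b ∷ x) (extend 1 (scale (p ∸ 1) C))
    ≡⟨ cong₂ _+_ (eval-extend b x 0 C) (eval-extend b x 1 (scale (p ∸ 1) C)) ⟩
      1 * eval x C + bit b ^ 1 * eval x (scale (p ∸ 1) C)
    ≡⟨ cong₂ _+_ (*-identityˡ _) (cong₂ _*_ (*-identityʳ (bit b)) (eval-scale x (p ∸ 1) C)) ⟩
      eval x C + bit b * ((p ∸ 1) * eval x C)
    ∎
    where
    open ≡-Reasoning
    C = complement es

  eval-complement : ∀ {n} (x : Vec Bool n) (es : Vec ℕ n) →
    eval x (complement es) ≈ monomial (map not x) es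
  eval-complement [] [] = refl
  eval-complement (b ∷ x) (zero ∷ es) =
    trans (cong (_% p) (eval-extend b x 0 (complement es))) (≈-*ˡ 1 (eval-complement x es))
  eval-complement (false ∷ x) (suc e ∷ es) =
    trans (cong (_% p) (trans (eval-complement-suc false x e es) (+-identityʳ _)))
      (trans (eval-complement x es)
        (cong (_% p) (sym (trans (cong (_* monomial (map not x) es) (^-zeroˡ (suc e))) (*-identityˡ _)))))
  eval-complement (true ∷ x) (suc e ∷ es) =
    trans (cong (_% p) (trans (eval-complement-suc true x e es) (cong (C +_) (*-identityˡ _))))
      (trans (cong (λ q → q * C % p) (m+[n∸m]≡n {1} {p} (>-nonZero⁻¹ p))) (p*≈0 C))
    where
    C = eval x (complement es)

  DegLe-extend : ∀ {n B B'} e (P : Poly n) → DegLe B P → e + B ≤ B' → DegLe B' (extend e P)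
  DegLe-extend e P degP e+B≤B' = map⁺ (All.map (λ h → ≤-trans (+-monoʳ-≤ e h) e+B≤B') degP)

  DegLe-scale : ∀ {n B} k (P : Poly n) → DegLe B P → DegLe B (scale k P)
  DegLe-scale k P = map⁺

  DegLe-mono : ∀ {n B B'} → B ≤ B' → (P : Poly n) → DegLe B P → DegLe B' P
  DegLe-mono B≤B' P = All.map (λ h → ≤-trans h B≤B')

  DegLe-complement : ∀ {n} (es : Vec ℕ n) → DegLe (vsum es) (complement es)
  DegLe-complement [] = z≤n ∷ []
  DegLe-complement (zero ∷ es) = DegLe-extend 0 (complement es) (DegLe-complement es) ≤-refl
  DegLe-complement (suc e ∷ es) =
    ++⁺ (DegLe-extend 0 (complement es) (DegLe-complement es) (m≤n+m (vsum es) (suc e)))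
        (DegLe-extend 1 (scale (p ∸ 1) (complement es))
          (DegLe-scale (p ∸ 1) (complement es) (DegLe-complement es)) (s≤s (m≤n+m (vsum es) e)))

  substNot : ∀ {n} → Poly n → Poly n
  substNot L.[] = L.[]
  substNot ((c , es) L.∷ P) = scale c (complement es) L.++ substNot P

  eval-substNot : ∀ {n} (x : Vec Bool n) (P : Poly n) → eval x (substNot P) ≈ eval (map not x) P
  eval-substNot x L.[] = refl
  eval-substNot x ((c , es) L.∷ P) =
    trans (cong (_% p) (eval-++ x (scale c (complement es)) (substNot P)))
      (≈-+ (trans (cong (_% p) (eval-scale x c (complement es))) (≈-*ˡ c (eval-complement x es)))
           (eval-substNot x P))

  DegLe-substNot : ∀ {n d} (P : Poly n) → DegLe d P → DegLe d (substNot P)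
  DegLe-substNot L.[] [] = []
  DegLe-substNot ((c , es) L.∷ P) (deg-t ∷ degP) =
    ++⁺ (DegLe-scale c (complement es) (DegLe-mono deg-t (complement es) (DegLe-complement es)))
        (DegLe-substNot P degP)

  InZcl-map-not : ∀ {n d E E'} → ((x : Vec Bool n) → E (weight x) → E' (weight (map not x))) →
    (y : Vec Bool n) → InZcl p n d E y → InZcl p n d E' (map not y)
  InZcl-map-not E⇒E' y y∈cl P degP P-vanishes =
    ∣-resp-≈ (sym (eval-substNot y P))
      (y∈cl (substNot P) (DegLe-substNot P degP)
        (λ x x∈E → ∣-resp-≈ (eval-substNot x P) (P-vanishes (map not x) (E⇒E' x x∈E))))

  ZCl-reflect : ∀ {n d E} j → ZCl p n d E j → ZCl p n d (reflectSet n E) (n ∸ j)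
  ZCl-reflect {E = E} _ (y , refl , y∈cl) =
    map not y , weight-map-not y ,
    InZcl-map-not {E = E} {E' = reflectSet _ E} (λ x x∈E → weight x , x∈E , weight-map-not x) y y∈cl

proposition2p2 : (p : ℕ) → Prime p → (n : ℕ) → 1 ≤ n → (d : ℕ) → d ≤ n →
    (E : WSet) → ((e : ℕ) → E e → e ≤ n) →
    ((j : ℕ) → ZCl p n d E j → (m : ℕ) → n < m → ZCl p m d E j)
    × ((j : ℕ) → ZCl p n d E j → ZCl p n d (reflectSet n E) (n ∸ j))
    × ((j : ℕ) → ZCl p n d E j → (k : ℕ) → 0 < k → ZCl p (n + k) d (shiftSet k E) (j + k))
proposition2p2 p p-prime n _ d _ E _ = padZeros , Complement.ZCl-reflect p {{prime⇒nonZero p-prime}} , padOnes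
  where
  padZeros : (j : ℕ) → ZCl p n d E j → (m : ℕ) → n < m → ZCl p m d E j
  padZeros j j∈cl m n<m =
    subst₂ (λ m′ → ZCl p m′ d E) (m+[n∸m]≡n (<⇒≤ n<m)) (+weight-zeros j)
      (ZCl-++ {E' = E} zeros (λ e → subst E (sym (+weight-zeros e))) j∈cl)
    where
    zeros = replicate (m ∸ n) false
    +weight-zeros : ∀ a → a + weight zeros ≡ a
    +weight-zeros a = trans (cong (a +_) (weight-replicate-false (m ∸ n))) (+-identityʳ a)
  padOnes : (j : ℕ) → ZCl p n d E j → (k : ℕ) → 0 < k → ZCl p (n + k) d (shiftSet k E) (j + k)
  padOnes j j∈cl k _ =
    subst (ZCl p (n + k) d (shiftSet k E)) (cong (j +_) (weight-replicate-true k))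
      (ZCl-++ {E' = shiftSet k E} (replicate k true) (λ e e∈E → e , e∈E , cong (e +_) (weight-replicate-true k)) j∈cl)
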